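{- Let $i=\lambda z.z$, and let $x,y$ be distinct variables. Then $\langle x\,i\rangle\cong^\circ(\lambda y.\langle x\,i\rangle)\,\langle x\,i\rangle$, but $\langle x\,i\rangle$ and $(\lambda y.\langle x\,i\rangle)\,\langle x\,i\rangle$ are not normal-form bisimilar.
   Context: Calculus $\lambda_S$: terms $t ::= v \mid t\,t \mid \mathcal{S}k.t \mid \langle t\rangle$, values $v ::= x \mid \lambda x.t$; pure contexts $E ::= \square \mid v\,E \mid E\,t$; evaluation contexts $F ::= \square \mid v\,F \mid F\,t \mid \langle F\rangle$ (each is either pure or uniquely $F[\langle E\rangle]$ with $E$ pure); contexts $C ::= \square \mid \lambda x.C \mid t\,C \mid C\,t \mid \mathcal{S}k.C \mid \langle C\rangle$. Reduction: $F[(\lambda x.t)\,v] \to F[t\{v/x\}]$; $F[\langle E[\mathcal{S}k.t]\rangle] \to F[\langle t\{\lambda x.\langle E[x]\rangle/k\}\rangle]$ ($x\notin\mathrm{fv}(E)$); $F[\langle v\rangle]\to F[v]$. Stuck terms: control-stuck $E[\mathcal{S}k.t]$ and open-stuck $F[x\,v]$; normal form: value or stuck; $t\Downarrow t'$: $t\to^*t'$, $t'$ normal form. $t_0\cong t_1$ (closed) iff for every closed $C$, $C[t_0]$ evaluates to a value iff $C[t_1]$ does, and to a control-stuck term iff $C[t_1]$ does; $t_0\cong^\circ t_1$ iff $t_0\sigma\cong t_1\sigma$ for all substitutions $\sigma$ of closed values for free variables. Extensions of a relation $R$ ($x$ fresh): $E_0\,R^c\,E_1$ iff $E_0[x]\,R\,E_1[x]$;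 $F_0[\langle E_0\rangle]\,R^c\,F_1[\langle E_1\rangle]$ iff $\langle E_0[x]\rangle\,R\,\langle E_1[x]\rangle$ and $F_0[x]\,R\,F_1[x]$ (no other pairs); $v_0\,R^v\,v_1$ iff $v_0\,x\,R\,v_1\,x$; $E_0[\mathcal{S}k.t_0]\,R^{nf}\,E_1[\mathcal{S}k.t_1]$ iff $E_0\,R^c\,E_1$ and $\langle t_0\rangle\,R\,\langle t_1\rangle$; $F_0[y\,v_0]\,R^{nf}\,F_1[y\,v_1]$ iff $F_0\,R^c\,F_1$ and $v_0\,R^v\,v_1$. A normal-form bisimulation is a relation $R$ on open terms such that $t_0\,R\,t_1$ implies: if $t_0\to t_0'$ then $t_1\to^*t_1'$ with $t_0'\,R\,t_1'$; if $t_0$ is a value then $t_1\Downarrow v_1$ with $t_0\,R^v\,v_1$; if $t_0$ is stuck then $t_1\Downarrow t_1'$ with $t_0\,R^{nf}\,t_1'$; and symmetrically. Normal-form bisimilarity $\approx_{nf}$ is the largest normal-form bisimulation. -}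

module Defs where

open import Data.Nat using (ℕ; zero; suc; _<_)
open import Data.Product using (Σ; Σ-syntax; _×_; _,_)
open import Data.Sum using (_⊎_)
open import Function.Bundles using (_⇔_)
open import Relation.Binary.PropositionalEquality using (_≡_)
open import Relation.Binary.Construct.Closure.ReflexiveTransitive using (Star)

-- Syntax of λS, locally nameless-free pure de Bruijn representation.
-- var n : de Bruijn index n;  lam t : λx.t ;  sft t : Sk.t (k is index 0
-- in t) ;  rst t : ⟨t⟩.

data Tm : Set where
  var : ℕ → Tm
  lam : Tm → Tm
  app : Tm → Tm → Tm
  sft : Tm → Tm
  rst : Tm → Tm

data IsVal : Tm → Set where
  var : ∀ n → IsVal (var n)
  lam : ∀ t → IsVal (lam t)

ext : (ℕ → ℕ) → ℕ → ℕ
ext ρ zero    = zero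
ext ρ (suc n) = suc (ρ n)

rename : (ℕ → ℕ) → Tm → Tm
rename ρ (var n)   = var (ρ n)
rename ρ (lam t)   = lam (rename (ext ρ) t)
rename ρ (app t u) = app (rename ρ t) (rename ρ u)
rename ρ (sft t)   = sft (rename (ext ρ) t)
rename ρ (rst t)   = rst (rename ρ t)

↑_ : Tm → Tm
↑ t = rename suc t

exts : (ℕ → Tm) → ℕ → Tm
exts σ zero    = var zero
exts σ (suc n) = ↑ (σ n)

subst : (ℕ → Tm) → Tm → Tm
subst σ (var n)   = σ n
subst σ (lam t)   = lam (subst (exts σ) t)
subst σ (app t u) = app (subst σ t) (subst σ u)
subst σ (sft t)   = sft (subst (exts σ) t)
subst σ (rst t)   = rst (subst σ t)

sub0 : Tm → ℕ → Tm
sub0 v zero    = v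
sub0 v (suc n) = var n

_[_] : Tm → Tm → Tm
t [ v ] = subst (sub0 v) t

renameVal : ∀ ρ {v} → IsVal v → IsVal (rename ρ v)
renameVal ρ (var n) = var (ρ n)
renameVal ρ (lam t) = lam (rename (ext ρ) t)

data ECtx : Set where
  hole : ECtx
  appR : (v : Tm) → IsVal v → ECtx → ECtx
  appL : ECtx → Tm → ECtx

data FCtx : Set where
  hole : FCtx
  appR : (v : Tm) → IsVal v → FCtx → FCtx
  appL : FCtx → Tm → FCtx
  rst  : FCtx → FCtx

data Ctx : Set where
  hole : Ctx
  lam  : Ctx → Ctx
  appR : Tm → Ctx → Ctx
  appL : Ctx → Tm → Ctx
  sft  : Ctx → Ctx
  rst  : Ctx → Ctx

plugE : ECtx → Tm → Tm
plugE hole         t = t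
plugE (appR v _ E) t = app v (plugE E t)
plugE (appL E u)   t = app (plugE E t) u

plugF : FCtx → Tm → Tm
plugF hole         t = t
plugF (appR v _ F) t = app v (plugF F t)
plugF (appL F u)   t = app (plugF F t) u
plugF (rst F)      t = rst (plugF F t)

-- plugging (with capture) into a general context
plugC : Ctx → Tm → Tm
plugC hole       t = t
plugC (lam C)    t = lam (plugC C t)
plugC (appR u C) t = app u (plugC C t)
plugC (appL C u) t = app (plugC C t) u
plugC (sft C)    t = sft (plugC C t)
plugC (rst C)    t = rst (plugC C t)

renE : (ℕ → ℕ) → ECtx → ECtx
renE ρ hole          = hole
renE ρ (appR v p E)  = appR (rename ρ v) (renameVal ρ p) (renE ρ E)
renE ρ (appL E u)    = appL (renE ρ E) (rename ρ u)

renF : (ℕ → ℕ) → FCtx → FCtx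
renF ρ hole          = hole
renF ρ (appR v p F)  = appR (rename ρ v) (renameVal ρ p) (renF ρ F)
renF ρ (appL F u)    = appL (renF ρ F) (rename ρ u)
renF ρ (rst F)       = rst (renF ρ F)

embE : ECtx → FCtx
embE hole         = hole
embE (appR v p E) = appR v p (embE E)
embE (appL E u)   = appL (embE E) u

-- F[⟨E⟩] as an evaluation context
_∘⟨_⟩ : FCtx → ECtx → FCtx
hole         ∘⟨ E ⟩ = rst (embE E)
appR v p F   ∘⟨ E ⟩ = appR v p (F ∘⟨ E ⟩)
appL F u     ∘⟨ E ⟩ = appL (F ∘⟨ E ⟩) u
rst F        ∘⟨ E ⟩ = rst (F ∘⟨ E ⟩)

-- E[x], F[x] for a fresh variable x (x = index 0 after shifting)
E[x] : ECtx → Tm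
E[x] E = plugE (renE suc E) (var zero)

F[x] : FCtx → Tm
F[x] F = plugF (renF suc F) (var zero)

κ : ECtx → Tm
κ E = lam (rst (E[x] E))

infix 4 _⟶_ _⟶*_
data _⟶_ : Tm → Tm → Set where
  β     : ∀ F t v → IsVal v →
          plugF F (app (lam t) v) ⟶ plugF F (t [ v ])
  shift : ∀ F E t →
          plugF F (rst (plugE E (sft t))) ⟶ plugF F (rst (t [ κ E ]))
  reset : ∀ F v → IsVal v →
          plugF F (rst v) ⟶ plugF F v

_⟶*_ : Tm → Tm → Set
_⟶*_ = Star _⟶_

ControlStuck : Tm → Set
ControlStuck t = Σ[ E ∈ ECtx ] Σ[ u ∈ Tm ] t ≡ plugE E (sft u)

OpenStuck : Tm → Set
OpenStuck t = Σ[ F ∈ FCtx ] Σ[ x ∈ ℕ ] Σ[ v ∈ Tm ] IsVal v × t ≡ plugF F (app (var x) v)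

Stuck : Tm → Set
Stuck t = ControlStuck t ⊎ OpenStuck t

NormalForm : Tm → Set
NormalForm t = IsVal t ⊎ Stuck t

_⇓_ : Tm → Tm → Set
t ⇓ t' = (t ⟶* t') × NormalForm t'

data Scoped : ℕ → Tm → Set where
  var : ∀ {n i} → i < n → Scoped n (var i)
  lam : ∀ {n t} → Scoped (suc n) t → Scoped n (lam t)
  app : ∀ {n t u} → Scoped n t → Scoped n u → Scoped n (app t u)
  sft : ∀ {n t} → Scoped (suc n) t → Scoped n (sft t)
  rst : ∀ {n t} → Scoped n t → Scoped n (rst t)

Closed : Tm → Set
Closed = Scoped zero

data ScopedC : ℕ → Ctx → Set where
  hole : ∀ {n} → ScopedC n hole
  lam  : ∀ {n C} → ScopedC (suc n) C → ScopedC n (lam C)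
  appR : ∀ {n u C} → Scoped n u → ScopedC n C → ScopedC n (appR u C)
  appL : ∀ {n C u} → ScopedC n C → Scoped n u → ScopedC n (appL C u)
  sft  : ∀ {n C} → ScopedC (suc n) C → ScopedC n (sft C)
  rst  : ∀ {n C} → ScopedC n C → ScopedC n (rst C)

ClosedCtx : Ctx → Set
ClosedCtx = ScopedC zero

EvalsToValue : Tm → Set
EvalsToValue t = Σ[ v ∈ Tm ] (t ⟶* v) × IsVal v

EvalsToControlStuck : Tm → Set
EvalsToControlStuck t = Σ[ u ∈ Tm ] (t ⟶* u) × ControlStuck u

infix 4 _≅_ _≅°_ _≈nf_
_≅_ : Tm → Tm → Set
t₀ ≅ t₁ = Closed t₀ × Closed t₁ ×
  (∀ C → ClosedCtx C →
     (EvalsToValue (plugC C t₀) ⇔ EvalsToValue (plugC C t₁)) ×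
     (EvalsToControlStuck (plugC C t₀) ⇔ EvalsToControlStuck (plugC C t₁)))

ClosingSubst : (ℕ → Tm) → Set
ClosingSubst σ = ∀ n → IsVal (σ n) × Closed (σ n)

_≅°_ : Tm → Tm → Set
t₀ ≅° t₁ = ∀ σ → ClosingSubst σ → subst σ t₀ ≅ subst σ t₁

Rel : Set₁
Rel = Tm → Tm → Set

RcE : Rel → ECtx → ECtx → Set
RcE R E₀ E₁ = R (E[x] E₀) (E[x] E₁)

data RcF (R : Rel) : FCtx → FCtx → Set where
  pure  : ∀ E₀ E₁ → RcE R E₀ E₁ → RcF R (embE E₀) (embE E₁)
  delim : ∀ F₀ E₀ F₁ E₁ →
          R (rst (E[x] E₀)) (rst (E[x] E₁)) →
          R (F[x] F₀) (F[x] F₁) →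
          RcF R (F₀ ∘⟨ E₀ ⟩) (F₁ ∘⟨ E₁ ⟩)

Rv : Rel → Tm → Tm → Set
Rv R v₀ v₁ = R (app (↑ v₀) (var zero)) (app (↑ v₁) (var zero))

data Rnf (R : Rel) : Tm → Tm → Set where
  control : ∀ E₀ E₁ t₀ t₁ → RcE R E₀ E₁ → R (rst t₀) (rst t₁) →
            Rnf R (plugE E₀ (sft t₀)) (plugE E₁ (sft t₁))
  open-   : ∀ F₀ F₁ y v₀ v₁ → IsVal v₀ → IsVal v₁ →
            RcF R F₀ F₁ → Rv R v₀ v₁ →
            Rnf R (plugF F₀ (app (var y) v₀)) (plugF F₁ (app (var y) v₁))

flipR : Rel → Rel
flipR R t₀ t₁ = R t₁ t₀

Simulates : Rel → Set
Simulates R = ∀ t₀ t₁ → R t₀ t₁ →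
  (∀ t₀' → t₀ ⟶ t₀' → Σ[ t₁' ∈ Tm ] (t₁ ⟶* t₁') × R t₀' t₁') ×
  (IsVal t₀ → Σ[ v₁ ∈ Tm ] (t₁ ⟶* v₁) × IsVal v₁ × Rv R t₀ v₁) ×
  (Stuck t₀ → Σ[ t₁' ∈ Tm ] (t₁ ⇓ t₁') × Rnf R t₀ t₁')

NFBisimulation : Rel → Set
NFBisimulation R = Simulates R × Simulates (flipR R)

_≈nf_ : Tm → Tm → Set₁
t₀ ≈nf t₁ = Σ[ R ∈ Rel ] NFBisimulation R × R t₀ t₁

I : Tm
I = lam (var zero)

xi : ℕ → Tm
xi x = rst (app (var x) I)

-- (λy.⟨x i⟩) ⟨x i⟩ ; under the binder y, x has index suc x
yxi : ℕ → Tm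
yxi x = app (lam (xi (suc x))) (xi x)

-- ⟨x i⟩ and (λy.⟨x i⟩)⟨x i⟩ are contextually equivalent because a closed
-- delimited term ⟨t⟩ is idempotent: under a closing substitution the
-- redex (λ_.⟨t⟩)⟨t⟩ first runs ⟨t⟩, which can neither be control-stuck nor
-- open-stuck, and if it yields a value the body just reruns the same closed,
-- deterministic computation. This is made precise by simulations between
-- the congruence closures of two small relations on closed terms.
--
-- Normal-form bisimilarity fails because both terms are open-stuck on x i,
-- with evaluation contexts ⟨□⟩ and (λy.⟨x i⟩)⟨□⟩. Relating these contexts
-- forces a fresh variable z to be related to (λy.⟨x i⟩) z; but z is a value
-- while (λy.⟨x i⟩) z only reduces to the stuck term ⟨x i⟩.
{-# OPTIONS --safe #-}
module Submission where

open import Defs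
open import Data.Nat using (ℕ; zero; suc; _<_; z≤n; s≤s)
open import Data.Product using (_×_; _,_; ∃-syntax; proj₁; proj₂)
open import Data.Sum using (_⊎_; inj₁; inj₂)
open import Data.Empty using (⊥-elim)
open import Function.Bundles using (mk⇔)
open import Relation.Nullary using (¬_)
open import Relation.Binary.PropositionalEquality
  using (_≡_; _≢_; refl; sym; cong; cong₂) renaming (subst to ≡-subst; subst₂ to ≡-subst₂)
open import Relation.Binary.Construct.Closure.ReflexiveTransitive using (ε; _◅_; _◅◅_)

private
  variable
    m n : ℕ
    a b c d q s s' t t' u u' v v' w : Tm
    E E' : ECtx
    F : FCtx

ext-scoped : {ρ : ℕ → ℕ} → (∀ {i} → i < m → ρ i < n) →
             ∀ {i} → i < suc m → ext ρ i < suc n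
ext-scoped h {zero}  _         = s≤s z≤n
ext-scoped h {suc i} (s≤s i<m) = s≤s (h i<m)

rename-scoped : {ρ : ℕ → ℕ} → (∀ {i} → i < m → ρ i < n) → Scoped m t → Scoped n (rename ρ t)
rename-scoped h (var i<m) = var (h i<m)
rename-scoped h (lam t)   = lam (rename-scoped (ext-scoped h) t)
rename-scoped h (app t u) = app (rename-scoped h t) (rename-scoped h u)
rename-scoped h (sft t)   = sft (rename-scoped (ext-scoped h) t)
rename-scoped h (rst t)   = rst (rename-scoped h t)

exts-scoped : {σ : ℕ → Tm} → (∀ {i} → i < m → Scoped n (σ i)) →
              ∀ {i} → i < suc m → Scoped (suc n) (exts σ i)
exts-scoped h {zero}  _         = var (s≤s z≤n)
exts-scoped h {suc i} (s≤s i<m) = rename-scoped s≤s (h i<m)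

subst-scoped : {σ : ℕ → Tm} → (∀ {i} → i < m → Scoped n (σ i)) → Scoped m t → Scoped n (subst σ t)
subst-scoped h (var i<m) = h i<m
subst-scoped h (lam t)   = lam (subst-scoped (exts-scoped h) t)
subst-scoped h (app t u) = app (subst-scoped h t) (subst-scoped h u)
subst-scoped h (sft t)   = sft (subst-scoped (exts-scoped h) t)
subst-scoped h (rst t)   = rst (subst-scoped h t)

sub0-scoped : Scoped n v → ∀ {i} → i < suc n → Scoped n (sub0 v i)
sub0-scoped v {zero}  _         = v
sub0-scoped v {suc i} (s≤s i<n) = var i<n

ext-id : {ρ : ℕ → ℕ} → (∀ {i} → i < m → ρ i ≡ i) → ∀ {i} → i < suc m → ext ρ i ≡ i
ext-id h {zero}  _         = refl
ext-id h {suc i} (s≤s i<m) = cong suc (h i<m)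

rename-id : {ρ : ℕ → ℕ} → (∀ {i} → i < m → ρ i ≡ i) → Scoped m t → rename ρ t ≡ t
rename-id h (var i<m) = cong var (h i<m)
rename-id h (lam t)   = cong lam (rename-id (ext-id h) t)
rename-id h (app t u) = cong₂ app (rename-id h t) (rename-id h u)
rename-id h (sft t)   = cong sft (rename-id (ext-id h) t)
rename-id h (rst t)   = cong rst (rename-id h t)

exts-id : {σ : ℕ → Tm} → (∀ {i} → i < m → σ i ≡ var i) → ∀ {i} → i < suc m → exts σ i ≡ var i
exts-id h {zero}  _         = refl
exts-id h {suc i} (s≤s i<m) = cong ↑_ (h i<m)

subst-id : {σ : ℕ → Tm} → (∀ {i} → i < m → σ i ≡ var i) → Scoped m t → subst σ t ≡ t
subst-id h (var i<m) = h i<m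
subst-id h (lam t)   = cong lam (subst-id (exts-id h) t)
subst-id h (app t u) = cong₂ app (subst-id h t) (subst-id h u)
subst-id h (sft t)   = cong sft (subst-id (exts-id h) t)
subst-id h (rst t)   = cong rst (subst-id h t)

closed-rename : {ρ : ℕ → ℕ} → Closed t → rename ρ t ≡ t
closed-rename = rename-id λ ()

closed-subst : {σ : ℕ → Tm} → Closed t → subst σ t ≡ t
closed-subst = subst-id λ ()

closed-scoped : Closed t → Scoped n t
closed-scoped {t} {n} t-closed =
  ≡-subst (Scoped n) (closed-rename {ρ = suc} t-closed) (rename-scoped (λ ()) t-closed)

plugF-scoped-inv : ∀ F → Scoped n (plugF F s) →
                   Scoped n s × (∀ {s'} → Scoped n s' → Scoped n (plugF F s'))
plugF-scoped-inv hole         s       = s , λ s' → s'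
plugF-scoped-inv (appR _ _ F) (app v t) with plugF-scoped-inv F t
... | s , plug = s , λ s' → app v (plug s')
plugF-scoped-inv (appL F _)   (app t u) with plugF-scoped-inv F t
... | s , plug = s , λ s' → app (plug s') u
plugF-scoped-inv (rst F)      (rst t)   with plugF-scoped-inv F t
... | s , plug = s , λ s' → rst (plug s')

plugE-scoped-inv : ∀ E → Scoped n (plugE E s) → Scoped n s
plugE-scoped-inv hole         s         = s
plugE-scoped-inv (appR _ _ E) (app _ t) = plugE-scoped-inv E t
plugE-scoped-inv (appL E _)   (app t _) = plugE-scoped-inv E t

renE-suc-scoped : ∀ E → Scoped n (plugE E s) → Scoped (suc n) s' →
                  Scoped (suc n) (plugE (renE suc E) s')
renE-suc-scoped hole         _         s' = s'
renE-suc-scoped (appR _ _ E) (app v t) s' = app (rename-scoped s≤s v) (renE-suc-scoped E t s')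
renE-suc-scoped (appL E _)   (app t u) s' = app (renE-suc-scoped E t s') (rename-scoped s≤s u)

κ-scoped : ∀ E → Scoped n (plugE E s) → Scoped n (κ E)
κ-scoped E t = lam (rst (renE-suc-scoped E t (var (s≤s z≤n))))

infix 4 _↦_
data _↦_ : Tm → Tm → Set where
  β↦     : ∀ t v → IsVal v → app (lam t) v ↦ t [ v ]
  shift↦ : ∀ E t → rst (plugE E (sft t)) ↦ rst (t [ κ E ])
  reset↦ : ∀ v → IsVal v → rst v ↦ v

data Decomposition (t u : Tm) : Set where
  decomposition : ∀ F {s s'} → s ↦ s' → t ≡ plugF F s → u ≡ plugF F s' → Decomposition t u

decompose : t ⟶ u → Decomposition t u
decompose (β F t v v-val)     = decomposition F (β↦ t v v-val) refl refl
decompose (shift F E t)       = decomposition F (shift↦ E t) refl refl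
decompose (reset F v v-val)   = decomposition F (reset↦ v v-val) refl refl

plugF-↦ : ∀ F → s ↦ s' → plugF F s ⟶ plugF F s'
plugF-↦ F (β↦ t v v-val)   = β F t v v-val
plugF-↦ F (shift↦ E t)     = shift F E t
plugF-↦ F (reset↦ v v-val) = reset F v v-val

↦-scoped : s ↦ s' → Scoped n s → Scoped n s'
↦-scoped (β↦ _ _ _)   (app (lam t) v) = subst-scoped (sub0-scoped v) t
↦-scoped (shift↦ E _) (rst Es) with plugE-scoped-inv E Es
... | sft t = rst (subst-scoped (sub0-scoped (κ-scoped E Es)) t)
↦-scoped (reset↦ _ _) (rst v)         = v

⟶-scoped : Scoped n t → t ⟶ u → Scoped n u
⟶-scoped t st with decompose st
... | decomposition F r refl refl with plugF-scoped-inv F t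
... | s , plug = plug (↦-scoped r s)

_∘F_ : FCtx → FCtx → FCtx
hole       ∘F G = G
appR v p F ∘F G = appR v p (F ∘F G)
appL F u   ∘F G = appL (F ∘F G) u
rst F      ∘F G = rst (F ∘F G)

plugF-∘F : ∀ F G s → plugF (F ∘F G) s ≡ plugF F (plugF G s)
plugF-∘F hole         G s = refl
plugF-∘F (appR v p F) G s = cong (app v) (plugF-∘F F G s)
plugF-∘F (appL F u)   G s = cong (λ t → app t u) (plugF-∘F F G s)
plugF-∘F (rst F)      G s = cong rst (plugF-∘F F G s)

⟶-plugF : ∀ F → t ⟶ u → plugF F t ⟶ plugF F u
⟶-plugF F st with decompose st
... | decomposition G {s} {s'} r refl refl =
  ≡-subst₂ _⟶_ (plugF-∘F F G s) (plugF-∘F F G s') (plugF-↦ (F ∘F G) r)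

⟶*-plugF : ∀ F → t ⟶* u → plugF F t ⟶* plugF F u
⟶*-plugF F ε         = ε
⟶*-plugF F (st ◅ sts) = ⟶-plugF F st ◅ ⟶*-plugF F sts

IsVal-irrelevant : (p p' : IsVal v) → p ≡ p'
IsVal-irrelevant (var n) (var n) = refl
IsVal-irrelevant (lam t) (lam t) = refl

app-injˡ : app a b ≡ app c d → a ≡ c
app-injˡ refl = refl

app-injʳ : app a b ≡ app c d → b ≡ d
app-injʳ refl = refl

rst-inj : rst a ≡ rst b → a ≡ b
rst-inj refl = refl

plugF-app-nonvalue : ∀ F → ¬ IsVal (plugF F (app a b))
plugF-app-nonvalue hole         ()
plugF-app-nonvalue (appR _ _ _) ()
plugF-app-nonvalue (appL _ _)   ()
plugF-app-nonvalue (rst _)      ()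

plugF-↦-nonvalue : ∀ F → s ↦ s' → ¬ IsVal (plugF F s)
plugF-↦-nonvalue hole         (β↦ _ _ _)   ()
plugF-↦-nonvalue hole         (shift↦ _ _) ()
plugF-↦-nonvalue hole         (reset↦ _ _) ()
plugF-↦-nonvalue (appR _ _ _) _            ()
plugF-↦-nonvalue (appL _ _)   _            ()
plugF-↦-nonvalue (rst _)      _            ()

value≢plugF-↦ : IsVal v → s ↦ s' → v ≢ plugF F s
value≢plugF-↦ {F = F} v-val r refl = plugF-↦-nonvalue F r v-val

plugE-sft-nonvalue : ∀ E → ¬ IsVal (plugE E (sft t))
plugE-sft-nonvalue hole         ()
plugE-sft-nonvalue (appR _ _ _) ()
plugE-sft-nonvalue (appL _ _)   ()

value≢plugE-sft : IsVal v → v ≢ plugE E (sft t)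
value≢plugE-sft {E = E} v-val refl = plugE-sft-nonvalue E v-val

rst≢plugE-sft : ∀ E → rst q ≢ plugE E (sft t)
rst≢plugE-sft hole         ()
rst≢plugE-sft (appR _ _ _) ()
rst≢plugE-sft (appL _ _)   ()

plugE-sft≢plugF-↦ : ∀ E G → s ↦ s' → plugE E (sft t) ≢ plugF G s
plugE-sft≢plugF-↦ hole         hole         (β↦ _ _ _)   ()
plugE-sft≢plugF-↦ hole         hole         (shift↦ _ _) ()
plugE-sft≢plugF-↦ hole         hole         (reset↦ _ _) ()
plugE-sft≢plugF-↦ hole         (appR _ _ _) _            ()
plugE-sft≢plugF-↦ hole         (appL _ _)   _            ()
plugE-sft≢plugF-↦ hole         (rst _)      _            ()
plugE-sft≢plugF-↦ (appR _ _ E) hole         (β↦ _ _ v)   eq = value≢plugE-sft v (sym (app-injʳ eq))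
plugE-sft≢plugF-↦ (appR _ _ _) hole         (shift↦ _ _) ()
plugE-sft≢plugF-↦ (appR _ _ _) hole         (reset↦ _ _) ()
plugE-sft≢plugF-↦ (appR _ _ E) (appR _ _ G) r            eq = plugE-sft≢plugF-↦ E G r (app-injʳ eq)
plugE-sft≢plugF-↦ (appR _ p _) (appL _ _)   r            eq = value≢plugF-↦ p r (app-injˡ eq)
plugE-sft≢plugF-↦ (appR _ _ _) (rst _)      _            ()
plugE-sft≢plugF-↦ (appL E _)   hole         (β↦ t _ _)   eq = value≢plugE-sft (lam t) (sym (app-injˡ eq))
plugE-sft≢plugF-↦ (appL _ _)   hole         (shift↦ _ _) ()
plugE-sft≢plugF-↦ (appL _ _)   hole         (reset↦ _ _) ()
plugE-sft≢plugF-↦ (appL E _)   (appR _ p _) _            eq = value≢plugE-sft p (sym (app-injˡ eq))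
plugE-sft≢plugF-↦ (appL E _)   (appL G _)   r            eq = plugE-sft≢plugF-↦ E G r (app-injˡ eq)
plugE-sft≢plugF-↦ (appL _ _)   (rst _)      _            ()

-- The immediate subterms of a redex are values or E[Sk.t], which contain no redex.
↦-no-inner-redex : ∀ G → s ↦ s' → t ↦ t' → s ≡ plugF G t → G ≡ hole
↦-no-inner-redex hole         _              _ _  = refl
↦-no-inner-redex (appR _ _ G) (β↦ _ _ v)     r eq = ⊥-elim (value≢plugF-↦ v r (app-injʳ eq))
↦-no-inner-redex (appL G _)   (β↦ t _ _)     r eq = ⊥-elim (value≢plugF-↦ (lam t) r (app-injˡ eq))
↦-no-inner-redex (rst G)      (shift↦ E _)   r eq = ⊥-elim (plugE-sft≢plugF-↦ E G r (rst-inj eq))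
↦-no-inner-redex (rst G)      (reset↦ _ v)   r eq = ⊥-elim (value≢plugF-↦ v r (rst-inj eq))
↦-no-inner-redex (appR _ _ _) (shift↦ _ _)   _ ()
↦-no-inner-redex (appR _ _ _) (reset↦ _ _)   _ ()
↦-no-inner-redex (appL _ _)   (shift↦ _ _)   _ ()
↦-no-inner-redex (appL _ _)   (reset↦ _ _)   _ ()
↦-no-inner-redex (rst _)      (β↦ _ _ _)     _ ()

plugF-↦-injective : ∀ F G → s ↦ s' → t ↦ t' → plugF F s ≡ plugF G t → F ≡ G × s ≡ t
plugF-↦-injective hole G r r' eq with ↦-no-inner-redex G r r' eq
... | refl = refl , eq
plugF-↦-injective F@(appR _ _ _) hole r r' eq with ↦-no-inner-redex F r' r (sym eq)
... | ()
plugF-↦-injective F@(appL _ _) hole r r' eq with ↦-no-inner-redex F r' r (sym eq)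
... | ()
plugF-↦-injective F@(rst _) hole r r' eq with ↦-no-inner-redex F r' r (sym eq)
... | ()
plugF-↦-injective (appR v p F) (appR w p' G) r r' eq
  with app-injˡ eq | plugF-↦-injective F G r r' (app-injʳ eq)
... | refl | refl , s≡t = cong (λ p → appR v p F) (IsVal-irrelevant p p') , s≡t
plugF-↦-injective (appR _ p _) (appL G _)   _ r' eq = ⊥-elim (value≢plugF-↦ p r' (app-injˡ eq))
plugF-↦-injective (appL F _)   (appR _ p _) r _  eq = ⊥-elim (value≢plugF-↦ p r (sym (app-injˡ eq)))
plugF-↦-injective (appL F u)   (appL G u')  r r' eq
  with app-injʳ eq | plugF-↦-injective F G r r' (app-injˡ eq)
... | refl | refl , s≡t = refl , s≡t
plugF-↦-injective (rst F)      (rst G)      r r' eq with plugF-↦-injective F G r r' (rst-inj eq)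
... | refl , s≡t = refl , s≡t
plugF-↦-injective (appR _ _ _) (rst _)      _ _ ()
plugF-↦-injective (appL _ _)   (rst _)      _ _ ()
plugF-↦-injective (rst _)      (appR _ _ _) _ _ ()
plugF-↦-injective (rst _)      (appL _ _)   _ _ ()

plugE-sft-injective : ∀ E E' → plugE E (sft t) ≡ plugE E' (sft t') → E ≡ E' × t ≡ t'
plugE-sft-injective hole         hole          refl = refl , refl
plugE-sft-injective (appR v p E) (appR v' p' E') eq
  with app-injˡ eq | plugE-sft-injective E E' (app-injʳ eq)
... | refl | refl , t≡t' = cong (λ p → appR v p E) (IsVal-irrelevant p p') , t≡t'
plugE-sft-injective (appR _ p _) (appL _ _)     eq = ⊥-elim (value≢plugE-sft p (app-injˡ eq))
plugE-sft-injective (appL _ _)   (appR _ p _)   eq = ⊥-elim (value≢plugE-sft p (sym (app-injˡ eq)))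
plugE-sft-injective (appL E u)   (appL E' u')   eq
  with app-injʳ eq | plugE-sft-injective E E' (app-injˡ eq)
... | refl | refl , t≡t' = refl , t≡t'
plugE-sft-injective hole         (appR _ _ _)   ()
plugE-sft-injective hole         (appL _ _)     ()
plugE-sft-injective (appR _ _ _) hole           ()
plugE-sft-injective (appL _ _)   hole           ()

↦-det : s ↦ s' → t ↦ t' → s ≡ t → s' ≡ t'
↦-det (β↦ _ _ _)   (β↦ _ _ _)   refl = refl
↦-det (shift↦ E _) (shift↦ E' _) eq with plugE-sft-injective E E' (rst-inj eq)
... | refl , refl = refl
↦-det (shift↦ E _) (reset↦ _ v) eq = ⊥-elim (value≢plugE-sft v (sym (rst-inj eq)))
↦-det (reset↦ _ v) (shift↦ E _) eq = ⊥-elim (value≢plugE-sft v (rst-inj eq))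
↦-det (reset↦ _ _) (reset↦ _ _) refl = refl
↦-det (β↦ _ _ _)   (shift↦ _ _) ()
↦-det (β↦ _ _ _)   (reset↦ _ _) ()
↦-det (shift↦ _ _) (β↦ _ _ _)   ()
↦-det (reset↦ _ _) (β↦ _ _ _)   ()

⟶-det : t ⟶ u → t ⟶ u' → u ≡ u'
⟶-det st st' with decompose st | decompose st'
... | decomposition F r refl refl | decomposition G r' eq refl
  with plugF-↦-injective F G r r' eq
... | refl , s≡t = cong (plugF F) (↦-det r r' s≡t)

value-irreducible : IsVal v → ¬ (v ⟶ u)
value-irreducible v-val st with decompose st
... | decomposition F r refl refl = plugF-↦-nonvalue F r v-val

value-⟶* : IsVal v → v ⟶* u → u ≡ v
value-⟶* v-val ε          = refl
value-⟶* v-val (st ◅ _) = ⊥-elim (value-irreducible v-val st)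

irreducible-⟶* : (∀ {u} → ¬ (t ⟶ u)) → t ⟶* u → u ≡ t
irreducible-⟶* irr ε        = refl
irreducible-⟶* irr (st ◅ _) = ⊥-elim (irr st)

⟶*-scoped : Scoped n t → t ⟶* u → Scoped n u
⟶*-scoped t ε          = t
⟶*-scoped t (st ◅ sts) = ⟶*-scoped (⟶-scoped t st) sts

app-value-⟶ : IsVal w → ¬ IsVal c → app w c ⟶ u → ∃[ c' ] (c ⟶ c') × u ≡ app w c'
app-value-⟶ w-val c-nonvalue st with decompose st
... | decomposition hole         (β↦ _ _ v)   refl refl = ⊥-elim (c-nonvalue v)
... | decomposition hole         (shift↦ _ _) ()   _
... | decomposition hole         (reset↦ _ _) ()   _
... | decomposition (appR _ _ G) r            refl refl = _ , plugF-↦ G r , refl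
... | decomposition (appL G _)   r            eq   _    = ⊥-elim (value≢plugF-↦ w-val r (app-injˡ eq))
... | decomposition (rst _)      _            ()   _

rst-⟶ : rst q ⟶ u → (∃[ q' ] u ≡ rst q') ⊎ IsVal u
rst-⟶ st with decompose st
... | decomposition hole         (shift↦ _ _) refl refl = inj₁ (_ , refl)
... | decomposition hole         (reset↦ _ v) refl refl = inj₂ v
... | decomposition hole         (β↦ _ _ _)   ()   _
... | decomposition (rst _)      _            refl refl = inj₁ (_ , refl)
... | decomposition (appR _ _ _) _            ()   _
... | decomposition (appL _ _)   _            ()   _

rst-nonControlStuck : ¬ ControlStuck (rst q)
rst-nonControlStuck (E , _ , eq) = rst≢plugE-sft E eq

value-nonControlStuck : IsVal v → ¬ ControlStuck v
value-nonControlStuck v-val (_ , _ , eq) = value≢plugE-sft v-val eq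

app-value-nonControlStuck : IsVal w → ¬ ControlStuck c → ¬ ControlStuck (app w c)
app-value-nonControlStuck w-val ¬c-cs (hole , _ , ())
app-value-nonControlStuck w-val ¬c-cs (appR _ _ E , t , eq) = ¬c-cs (E , t , app-injʳ eq)
app-value-nonControlStuck w-val ¬c-cs (appL _ _ , _ , eq)   = value≢plugE-sft w-val (app-injˡ eq)

data Cong (P : Rel) : Rel where
  base : P s s' → Cong P s s'
  var  : ∀ n → Cong P (var n) (var n)
  lam  : Cong P t t' → Cong P (lam t) (lam t')
  app  : Cong P t t' → Cong P u u' → Cong P (app t u) (app t' u')
  sft  : Cong P t t' → Cong P (sft t) (sft t')
  rst  : Cong P t t' → Cong P (rst t) (rst t')

data CongE (P : Rel) : ECtx → ECtx → Set where
  hole : CongE P hole hole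
  appR : ∀ {v v' p p' E E'} → Cong P v v' → CongE P E E' → CongE P (appR v p E) (appR v' p' E')
  appL : ∀ {E E'} → CongE P E E' → Cong P u u' → CongE P (appL E u) (appL E' u')

Cong-refl : ∀ {P} t → Cong P t t
Cong-refl (var n)   = var n
Cong-refl (lam t)   = lam (Cong-refl t)
Cong-refl (app t u) = app (Cong-refl t) (Cong-refl u)
Cong-refl (sft t)   = sft (Cong-refl t)
Cong-refl (rst t)   = rst (Cong-refl t)

plugC-Cong : ∀ {P} C → P s s' → Cong P (plugC C s) (plugC C s')
plugC-Cong hole       p = base p
plugC-Cong (lam C)    p = lam (plugC-Cong C p)
plugC-Cong (appR u C) p = app (Cong-refl u) (plugC-Cong C p)
plugC-Cong (appL C u) p = app (plugC-Cong C p) (Cong-refl u)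
plugC-Cong (sft C)    p = sft (plugC-Cong C p)
plugC-Cong (rst C)    p = rst (plugC-Cong C p)

record ClosedSimulation (P : Rel) : Set where
  field
    closed            : ∀ {s s'} → P s s' → Closed s × Closed s'
    nonvalue          : ∀ {s s'} → P s s' → ¬ IsVal s
    nonControlStuck   : ∀ {s s'} → P s s' → ¬ ControlStuck s
    simulate          : ∀ {s s' u} → P s s' → s ⟶ u → ∃[ u' ] (s' ⟶* u') × Cong P u u'

module _ {P : Rel} (S : ClosedSimulation P) where
  open ClosedSimulation S

  Cong-rename : {ρ : ℕ → ℕ} → Cong P t t' → Cong P (rename ρ t) (rename ρ t')
  Cong-rename (base p) with closed p
  ... | s , s' = ≡-subst₂ (Cong P) (sym (closed-rename s)) (sym (closed-rename s')) (base p)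
  Cong-rename (var n)   = var _
  Cong-rename (lam c)   = lam (Cong-rename c)
  Cong-rename (app c d) = app (Cong-rename c) (Cong-rename d)
  Cong-rename (sft c)   = sft (Cong-rename c)
  Cong-rename (rst c)   = rst (Cong-rename c)

  Cong-exts : {σ σ' : ℕ → Tm} → (∀ n → Cong P (σ n) (σ' n)) → ∀ n → Cong P (exts σ n) (exts σ' n)
  Cong-exts h zero    = var zero
  Cong-exts h (suc n) = Cong-rename (h n)

  Cong-subst : {σ σ' : ℕ → Tm} → (∀ n → Cong P (σ n) (σ' n)) → Cong P t t' →
               Cong P (subst σ t) (subst σ' t')
  Cong-subst h (base p) with closed p
  ... | s , s' = ≡-subst₂ (Cong P) (sym (closed-subst s)) (sym (closed-subst s')) (base p)
  Cong-subst h (var n)   = h n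
  Cong-subst h (lam c)   = lam (Cong-subst (Cong-exts h) c)
  Cong-subst h (app c d) = app (Cong-subst h c) (Cong-subst h d)
  Cong-subst h (sft c)   = sft (Cong-subst (Cong-exts h) c)
  Cong-subst h (rst c)   = rst (Cong-subst h c)

  Cong-[] : Cong P t t' → Cong P v v' → Cong P (t [ v ]) (t' [ v' ])
  Cong-[] c d = Cong-subst sub0-Cong c
    where
    sub0-Cong : ∀ n → Cong P (sub0 _ n) (sub0 _ n)
    sub0-Cong zero    = d
    sub0-Cong (suc n) = var n

  Cong-value : IsVal v → Cong P v v' → IsVal v'
  Cong-value v-val (base p) = ⊥-elim (nonvalue p v-val)
  Cong-value v-val (var n)  = var n
  Cong-value v-val (lam _)  = lam _

  Cong-κ : CongE P E E' → Cong P (κ E) (κ E')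
  Cong-κ cE = lam (rst (plugE-Cong (renE-Cong cE) (var zero)))
    where
    renE-Cong : ∀ {E E'} → CongE P E E' → CongE P (renE suc E) (renE suc E')
    renE-Cong hole        = hole
    renE-Cong (appR c cE) = appR (Cong-rename c) (renE-Cong cE)
    renE-Cong (appL cE c) = appL (renE-Cong cE) (Cong-rename c)

    plugE-Cong : ∀ {E E'} → CongE P E E' → Cong P s s' → Cong P (plugE E s) (plugE E' s')
    plugE-Cong hole        c = c
    plugE-Cong (appR d cE) c = app d (plugE-Cong cE c)
    plugE-Cong (appL cE d) c = app (plugE-Cong cE c) d

  Cong-plugE-sft : ∀ E → Cong P (plugE E (sft t)) u →
                   ∃[ E' ] ∃[ t' ] u ≡ plugE E' (sft t') × CongE P E E' × Cong P t t'
  Cong-plugE-sft hole         (base p)  = ⊥-elim (nonControlStuck p (hole , _ , refl))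
  Cong-plugE-sft hole         (sft c)   = hole , _ , refl , hole , c
  Cong-plugE-sft (appR v p E) (base q)  = ⊥-elim (nonControlStuck q (appR v p E , _ , refl))
  Cong-plugE-sft (appR v p E) (app c d) with Cong-plugE-sft E d
  ... | E' , t' , refl , cE , ct = appR _ (Cong-value p c) E' , t' , refl , appR c cE , ct
  Cong-plugE-sft (appL E u)   (base q)  = ⊥-elim (nonControlStuck q (appL E u , _ , refl))
  Cong-plugE-sft (appL E u)   (app c d) with Cong-plugE-sft E c
  ... | E' , t' , refl , cE , ct = appL E' _ , t' , refl , appL cE d , ct

  -- A step inside a P-pair is simulated by P itself; otherwise the redex is
  -- built from congruent pieces and the other side contracts the matching redex.
  Cong-simulate-↦ : ∀ F → s ↦ s' → Cong P (plugF F s) u →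
                    ∃[ u' ] (u ⟶* u') × Cong P (plugF F s') u'
  Cong-simulate-↦ hole           r@(β↦ _ _ _)   (base p) = simulate p (plugF-↦ hole r)
  Cong-simulate-↦ hole           r@(shift↦ _ _) (base p) = simulate p (plugF-↦ hole r)
  Cong-simulate-↦ hole           r@(reset↦ _ _) (base p) = simulate p (plugF-↦ hole r)
  Cong-simulate-↦ F@(appR _ _ _) r              (base p) = simulate p (plugF-↦ F r)
  Cong-simulate-↦ F@(appL _ _)   r              (base p) = simulate p (plugF-↦ F r)
  Cong-simulate-↦ F@(rst _)      r              (base p) = simulate p (plugF-↦ F r)
  Cong-simulate-↦ hole (β↦ t _ _)   (app (base p) _) = ⊥-elim (nonvalue p (lam t))
  Cong-simulate-↦ hole (β↦ _ _ v)   (app (lam {t' = t'} c) d) =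
    _ , β hole t' _ (Cong-value v d) ◅ ε , Cong-[] c d
  Cong-simulate-↦ hole (shift↦ E _) (rst c) with Cong-plugE-sft E c
  ... | E' , t' , refl , cE , ct = _ , shift hole E' t' ◅ ε , rst (Cong-[] ct (Cong-κ cE))
  Cong-simulate-↦ hole (reset↦ _ v) (rst c) = _ , reset hole _ (Cong-value v c) ◅ ε , c
  Cong-simulate-↦ (appR _ p G) r (app c d) with Cong-simulate-↦ G r d
  ... | _ , sts , d' = _ , ⟶*-plugF (appR _ (Cong-value p c) hole) sts , app c d'
  Cong-simulate-↦ (appL G _)   r (app c d) with Cong-simulate-↦ G r c
  ... | _ , sts , c' = _ , ⟶*-plugF (appL hole _) sts , app c' d
  Cong-simulate-↦ (rst G)      r (rst c)   with Cong-simulate-↦ G r c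
  ... | _ , sts , c' = _ , ⟶*-plugF (rst hole) sts , rst c'

  Cong-simulate : Cong P t t' → t ⟶ u → ∃[ u' ] (t' ⟶* u') × Cong P u u'
  Cong-simulate c st with decompose st
  ... | decomposition F r refl refl = Cong-simulate-↦ F r c

  Cong-simulate* : Cong P t t' → t ⟶* u → ∃[ u' ] (t' ⟶* u') × Cong P u u'
  Cong-simulate* c ε          = _ , ε , c
  Cong-simulate* c (st ◅ sts) with Cong-simulate c st
  ... | _ , sts' , c' with Cong-simulate* c' sts
  ... | u' , sts'' , c'' = u' , sts' ◅◅ sts'' , c''

  Cong-EvalsToValue : Cong P t t' → EvalsToValue t → EvalsToValue t'
  Cong-EvalsToValue c (_ , sts , v-val) with Cong-simulate* c sts
  ... | v' , sts' , c' = v' , sts' , Cong-value v-val c'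

  Cong-EvalsToControlStuck : Cong P t t' → EvalsToControlStuck t → EvalsToControlStuck t'
  Cong-EvalsToControlStuck c (_ , sts , (E , _ , refl)) with Cong-simulate* c sts
  ... | _ , sts' , c' with Cong-plugE-sft E c'
  ... | E' , t' , refl , _ = _ , sts' , (E' , t' , refl)

ClosedSimulations⇒≅ : ∀ {P Q} → ClosedSimulation P → ClosedSimulation Q → P t u → Q u t → t ≅ u
ClosedSimulations⇒≅ SP SQ p q with ClosedSimulation.closed SP p
... | t-closed , u-closed = t-closed , u-closed , λ C _ →
    mk⇔ (Cong-EvalsToValue SP (plugC-Cong C p)) (Cong-EvalsToValue SQ (plugC-Cong C q)) ,
    mk⇔ (Cong-EvalsToControlStuck SP (plugC-Cong C p)) (Cong-EvalsToControlStuck SQ (plugC-Cong C q))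

module _ {t : Tm} (t-closed : Closed t) where
  private
    K : Tm
    K = lam (rst t)

    rst-t-closed : Closed (rst t)
    rst-t-closed = rst t-closed

    K-closed : Closed K
    K-closed = lam (closed-scoped rst-t-closed)

    K-β : IsVal v → app K v ⟶ rst t
    K-β {v} v-val = ≡-subst (app K v ⟶_) (closed-subst rst-t-closed) (β hole (rst t) v v-val)

    K-rst : rst q ⟶ u → app K (rst q) ⟶ app K u
    K-rst = ⟶-plugF (appR K (lam (rst t)) hole)

    reduct-closed : rst t ⟶* u → Closed u
    reduct-closed = ⟶*-scoped rst-t-closed

  data Forward : Rel where
    forward : ∀ q → rst t ⟶* rst q → Forward (rst q) (app K (rst q))

  -- K v restarts ⟨t⟩, which deterministically recomputes the value v it had returned.
  data Backward : Rel where
    running   : ∀ q → rst t ⟶* rst q → Backward (app K (rst q)) (rst q)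
    returned  : IsVal v → rst t ⟶* v → Backward (app K v) v
    rerunning : ∀ q → rst t ⟶* rst q → rst q ⟶* v → IsVal v → Backward (rst q) v

  forward-simulation : ClosedSimulation Forward
  forward-simulation = record
    { closed          = λ { (forward _ sts) → reduct-closed sts , app K-closed (reduct-closed sts) }
    ; nonvalue        = λ { (forward _ _) () }
    ; nonControlStuck = λ { (forward _ _) → rst-nonControlStuck }
    ; simulate        = simulate
    }
    where
    simulate : Forward s s' → s ⟶ u → ∃[ u' ] (s' ⟶* u') × Cong Forward u u'
    simulate (forward q sts) st with rst-⟶ st
    ... | inj₁ (q' , refl) = _ , K-rst st ◅ ε , base (forward q' (sts ◅◅ st ◅ ε))
    ... | inj₂ v-val       = _ , K-rst st ◅ K-β v-val ◅ (sts ◅◅ st ◅ ε) , Cong-refl _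

  backward-simulation : ClosedSimulation Backward
  backward-simulation = record
    { closed          = closed
    ; nonvalue        = nonvalue
    ; nonControlStuck = nonControlStuck
    ; simulate        = simulate
    }
    where
    closed : Backward s s' → Closed s × Closed s'
    closed (running _ sts)          = app K-closed (reduct-closed sts) , reduct-closed sts
    closed (returned _ sts)         = app K-closed (reduct-closed sts) , reduct-closed sts
    closed (rerunning _ sts sts' _) = reduct-closed sts , reduct-closed (sts ◅◅ sts')

    nonvalue : Backward s s' → ¬ IsVal s
    nonvalue (running _ _)       ()
    nonvalue (returned _ _)      ()
    nonvalue (rerunning _ _ _ _) ()

    nonControlStuck : Backward s s' → ¬ ControlStuck s
    nonControlStuck (running _ _)       = app-value-nonControlStuck (lam _) rst-nonControlStuck
    nonControlStuck (returned v-val _)  = app-value-nonControlStuck (lam _) (value-nonControlStuck v-val)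
    nonControlStuck (rerunning _ _ _ _) = rst-nonControlStuck

    simulate : Backward s s' → s ⟶ u → ∃[ u' ] (s' ⟶* u') × Cong Backward u u'
    simulate (running q sts) st with app-value-⟶ (lam _) (λ ()) st
    ... | c , st' , refl with rst-⟶ st'
    ... | inj₁ (q' , refl) = _ , st' ◅ ε , base (running q' (sts ◅◅ st' ◅ ε))
    ... | inj₂ c-val       = _ , st' ◅ ε , base (returned c-val (sts ◅◅ st' ◅ ε))
    simulate (returned v-val sts) st with ⟶-det st (K-β v-val)
    ... | refl = _ , ε , base (rerunning t ε sts v-val)
    simulate (rerunning q sts ε ()) _
    simulate (rerunning q sts (st' ◅ sts') v-val) st with ⟶-det st st' | rst-⟶ st
    ... | refl | inj₁ (q' , refl) = _ , ε , base (rerunning q' (sts ◅◅ st ◅ ε) sts' v-val)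
    ... | refl | inj₂ u-val with value-⟶* u-val sts'
    ... | refl = _ , ε , Cong-refl _

  rst-idempotent : rst t ≅ app (lam (rst t)) (rst t)
  rst-idempotent =
    ClosedSimulations⇒≅ forward-simulation backward-simulation (forward t ε) (running t ε)

xi≅°yxi : ∀ x → xi x ≅° yxi x
xi≅°yxi x σ σ-closing =
  ≡-subst (subst σ (xi x) ≅_) ↑σx≡σx (rst-idempotent (app σx-closed (lam (var (s≤s z≤n)))))
  where
  σx-closed : Closed (σ x)
  σx-closed = proj₂ (σ-closing x)

  ↑σx≡σx : app (lam (rst (app (σ x) I))) (subst σ (xi x)) ≡ subst σ (yxi x)
  ↑σx≡σx = cong (λ w → app (lam (rst (app w I))) (subst σ (xi x))) (sym (closed-rename σx-closed))

plugF-app≢value : ∀ F → IsVal v → plugF F (app a b) ≢ v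
plugF-app≢value F v-val refl = plugF-app-nonvalue F v-val

var-app≢plugE-sft : ∀ {y} E → IsVal v → app (var y) v ≢ plugE E (sft t)
var-app≢plugE-sft hole         _     ()
var-app≢plugE-sft (appR _ _ E) v-val eq = value≢plugE-sft v-val (app-injʳ eq)
var-app≢plugE-sft (appL E _)   _     eq = value≢plugE-sft (var _) (app-injˡ eq)

var-app≢plugF-↦ : ∀ {y} G → IsVal v → s ↦ s' → app (var y) v ≢ plugF G s
var-app≢plugF-↦ hole         _     (β↦ _ _ _)   ()
var-app≢plugF-↦ hole         _     (shift↦ _ _) ()
var-app≢plugF-↦ hole         _     (reset↦ _ _) ()
var-app≢plugF-↦ (appR _ _ G) v-val r eq = value≢plugF-↦ v-val r (app-injʳ eq)
var-app≢plugF-↦ (appL G _)   _     r eq = value≢plugF-↦ (var _) r (app-injˡ eq)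
var-app≢plugF-↦ (rst _)      _     _ ()

rst-var-app-irreducible : ∀ {y} → IsVal v → ¬ (rst (app (var y) v) ⟶ u)
rst-var-app-irreducible v-val st with decompose st
... | decomposition hole         (shift↦ E _) eq   _ = var-app≢plugE-sft E v-val (rst-inj eq)
... | decomposition hole         (reset↦ _ ()) refl _
... | decomposition hole         (β↦ _ _ _)   ()   _
... | decomposition (rst G)      r            eq   _ = var-app≢plugF-↦ G v-val r (rst-inj eq)
... | decomposition (appR _ _ _) _            ()   _
... | decomposition (appL _ _)   _            ()   _

xi-irreducible : ∀ x → ¬ (xi x ⟶ u)
xi-irreducible x = rst-var-app-irreducible (lam (var zero))

yxi-irreducible : ∀ x → ¬ (yxi x ⟶ u)
yxi-irreducible x st with app-value-⟶ (lam _) (λ ()) st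
... | _ , st' , _ = xi-irreducible x st'

xi-stuck : ∀ x → Stuck (xi x)
xi-stuck x = inj₂ (rst hole , x , I , lam (var zero) , refl)

plugF-var-app≡xi : ∀ {x y} F → plugF F (app (var y) v) ≡ xi x → F ≡ rst hole
plugF-var-app≡xi (rst hole)         _  = refl
plugF-var-app≡xi (rst (appR _ _ G)) eq = ⊥-elim (plugF-app≢value G (lam _) (app-injʳ (rst-inj eq)))
plugF-var-app≡xi (rst (appL G _))   eq = ⊥-elim (plugF-app≢value G (var _) (app-injˡ (rst-inj eq)))
plugF-var-app≡xi (rst (rst _))      ()
plugF-var-app≡xi hole               ()
plugF-var-app≡xi (appR _ _ _)       ()
plugF-var-app≡xi (appL _ _)         ()

plugF-var-app≡yxi : ∀ {x y} F → plugF F (app (var y) v) ≡ yxi x →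
                    ∃[ p ] F ≡ appR (lam (xi (suc x))) p (rst hole)
plugF-var-app≡yxi (appR _ p G) eq with app-injˡ eq | plugF-var-app≡xi G (app-injʳ eq)
... | refl | refl = p , refl
plugF-var-app≡yxi (appL G _)   eq = ⊥-elim (plugF-app≢value G (lam _) (app-injˡ eq))
plugF-var-app≡yxi hole         ()
plugF-var-app≡yxi (rst _)      ()

∘⟨⟩≡⟨□⟩ : ∀ F E → F ∘⟨ E ⟩ ≡ rst hole → F ≡ hole
∘⟨⟩≡⟨□⟩ hole               _ _  = refl
∘⟨⟩≡⟨□⟩ (rst hole)         _ ()
∘⟨⟩≡⟨□⟩ (rst (appR _ _ _)) _ ()
∘⟨⟩≡⟨□⟩ (rst (appL _ _))   _ ()
∘⟨⟩≡⟨□⟩ (rst (rst _))      _ ()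
∘⟨⟩≡⟨□⟩ (appR _ _ _)       _ ()
∘⟨⟩≡⟨□⟩ (appL _ _)         _ ()

∘⟨⟩≡appR⟨□⟩ : ∀ F E {p} → F ∘⟨ E ⟩ ≡ appR w p (rst hole) → F ≡ appR w p hole
∘⟨⟩≡appR⟨□⟩ (appR _ _ hole)         hole         refl = refl
∘⟨⟩≡appR⟨□⟩ (appR _ _ hole)         (appR _ _ _) ()
∘⟨⟩≡appR⟨□⟩ (appR _ _ hole)         (appL _ _)   ()
∘⟨⟩≡appR⟨□⟩ (appR _ _ (appR _ _ _)) _            ()
∘⟨⟩≡appR⟨□⟩ (appR _ _ (appL _ _))   _            ()
∘⟨⟩≡appR⟨□⟩ (appR _ _ (rst hole))   _            ()
∘⟨⟩≡appR⟨□⟩ (appR _ _ (rst (appR _ _ _))) _      ()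
∘⟨⟩≡appR⟨□⟩ (appR _ _ (rst (appL _ _))) _        ()
∘⟨⟩≡appR⟨□⟩ (appR _ _ (rst (rst _)))  _          ()
∘⟨⟩≡appR⟨□⟩ hole                    _            ()
∘⟨⟩≡appR⟨□⟩ (appL _ _)              _            ()
∘⟨⟩≡appR⟨□⟩ (rst _)                 _            ()

embE≢rst : ∀ E → embE E ≢ rst F
embE≢rst hole         ()
embE≢rst (appR _ _ _) ()
embE≢rst (appL _ _)   ()

RcF-⟨□⟩-appR⟨□⟩ : ∀ {R F₀ F₁ p} → RcF R F₀ F₁ → F₀ ≡ rst hole → F₁ ≡ appR w p (rst hole) →
                   R (var zero) (app (↑ w) (var zero))
RcF-⟨□⟩-appR⟨□⟩ (pure E₀ _ _) F₀≡ _ = ⊥-elim (embE≢rst E₀ F₀≡)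
RcF-⟨□⟩-appR⟨□⟩ (delim F₀ E₀ F₁ E₁ _ r) F₀≡ F₁≡
  with ∘⟨⟩≡⟨□⟩ F₀ E₀ F₀≡ | ∘⟨⟩≡appR⟨□⟩ F₁ E₁ F₁≡
... | refl | refl = r

Rnf-xi-yxi : ∀ {R x t₀ t₁} → Rnf R t₀ t₁ → t₀ ≡ xi x → t₁ ≡ yxi x →
             R (var zero) (app (↑ (lam (xi (suc x)))) (var zero))
Rnf-xi-yxi (control E₀ _ _ _ _ _) t₀≡ _ = ⊥-elim (rst≢plugE-sft E₀ (sym t₀≡))
Rnf-xi-yxi (open- F₀ F₁ _ _ _ _ _ rc _) t₀≡ t₁≡
  with plugF-var-app≡xi F₀ t₀≡ | plugF-var-app≡yxi F₁ t₁≡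
... | refl | _ , refl = RcF-⟨□⟩-appR⟨□⟩ rc refl refl

↑K-var-no-value : ∀ x → app (↑ (lam (xi (suc x)))) (var zero) ⟶* v → ¬ IsVal v
↑K-var-no-value x ε          ()
↑K-var-no-value x (st ◅ sts) v-val with ⟶-det st (β hole _ (var zero) (var zero))
... | refl with irreducible-⟶* (xi-irreducible (suc x)) sts
... | refl with v-val
... | ()

xi≉yxi : ∀ x → ¬ (xi x ≈nf yxi x)
xi≉yxi x (R , (simulates , _) , related) with proj₂ (proj₂ (simulates _ _ related)) (xi-stuck x)
... | t₁ , (yxi⟶*t₁ , _) , related-nf with irreducible-⟶* (yxi-irreducible x) yxi⟶*t₁
... | refl with proj₁ (proj₂ (simulates _ _ (Rnf-xi-yxi related-nf refl refl))) (var zero)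
... | _ , sts , v-val , _ = ↑K-var-no-value x sts v-val

proposition6p8 : (x : ℕ) → (xi x ≅° yxi x) × ¬ (xi x ≈nf yxi x)
proposition6p8 x = xi≅°yxi x , xi≉yxi x
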